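{- Let $D=(E,\mathcal{F})$ be a delta-matroid such that $\emptyset\in\mathcal{F}$ and $w(D)=w(D\star A)$ for every $A\subseteq E$. (1) If $D$ is even, then there is no element $x\in E$ belonging to every feasible set of maximum cardinality. Furthermore, if $\{a,b\}\in\mathcal{F}$, then every feasible set $F$ of maximum cardinality satisfies $a\in F$ or $b\in F$. (2) If $E\in\mathcal{F}$, then $\mathcal{F}$ is the power set of $E$.
   Context: A delta-matroid is a pair $D=(E,\mathcal{F})$ with $E$ finite and $\mathcal{F}$ a nonempty collection of subsets of $E$ (feasible sets) such that for all $F_1,F_2\in\mathcal{F}$ and $x\in F_1\Delta F_2$ there is $y\in F_1\Delta F_2$ (possibly $y=x$) with $F_1\Delta\{x,y\}\in\mathcal{F}$. For $A\subseteq E$, the twist $D\star A$ is $(E,\{A\Delta X: X\in\mathcal{F}\})$. The width $w(D)$ is the difference between the maximum and the minimum cardinality of a feasible set of $D$. $D$ is even if all its feasible sets have cardinalities of the same parity. -}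

module Defs where

open import Data.Nat using (ℕ; _≤_; _∸_; _%_)
open import Data.Bool using (_xor_)
open import Data.Vec using (zipWith)
open import Data.Fin using (Fin)
open import Data.Fin.Subset using (Subset; _∈_; ∣_∣)
open import Data.Product using (Σ; ∃; _×_)
open import Relation.Binary.PropositionalEquality using (_≡_)

-- Ground set E = Fin n; subsets of E are 'Subset n'.
-- A set system on E is a predicate on subsets (the feasible sets).
SetSystem : ℕ → Set₁
SetSystem n = Subset n → Set

_Δ_ : ∀ {n} → Subset n → Subset n → Subset n
X Δ Y = zipWith _xor_ X Y

infixl 6 _Δ_

record IsDeltaMatroid {n : ℕ} (ℱ : SetSystem n) : Set where
  field
    nonempty : ∃ λ F → ℱ F
    exchange : ∀ F₁ F₂ → ℱ F₁ → ℱ F₂ → ∀ x → x ∈ (F₁ Δ F₂) →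
               ∃ λ y → y ∈ (F₁ Δ F₂) × ℱ (F₁ Δ (Data.Fin.Subset.⁅ x ⁆ Data.Fin.Subset.∪ Data.Fin.Subset.⁅ y ⁆))

-- twist D ⋆ A : feasible sets are A Δ X for X feasible in D
-- (equivalently Y is feasible iff A Δ Y is feasible in D, as Δ is an involution)
twist : ∀ {n} → SetSystem n → Subset n → SetSystem n
twist ℱ A Y = ∃ λ X → ℱ X × Y ≡ A Δ X

IsMaxFeasible : ∀ {n} → SetSystem n → Subset n → Set
IsMaxFeasible ℱ X = ℱ X × (∀ Y → ℱ Y → ∣ Y ∣ ≤ ∣ X ∣)

IsMinFeasible : ∀ {n} → SetSystem n → Subset n → Set
IsMinFeasible ℱ X = ℱ X × (∀ Y → ℱ Y → ∣ X ∣ ≤ ∣ Y ∣)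

HasWidth : ∀ {n} → SetSystem n → ℕ → Set
HasWidth ℱ w = ∃ λ M → ∃ λ m → IsMaxFeasible ℱ M × IsMinFeasible ℱ m × w ≡ ∣ M ∣ ∸ ∣ m ∣

IsEven : ∀ {n} → SetSystem n → Set
IsEven ℱ = ∀ F₁ F₂ → ℱ F₁ → ℱ F₂ → ∣ F₁ ∣ % 2 ≡ ∣ F₂ ∣ % 2

{-# OPTIONS --safe #-}
module Submission where

-- As ∅ is feasible, the width of ℱ is the size of its largest feasible sets, and so is the width
-- of a twist ℱ ⋆ A with A feasible, since ∅ = A Δ A is feasible there.
-- (2) If E is feasible, ℱ ⋆ X has width |E|, which forces ∅ to be feasible in ℱ ⋆ X, i.e. X ∈ ℱ.
-- (1) If x lies in every maximum feasible set M, each {x} Δ X with X feasible is smaller than M: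
-- either x ∈ X, or X is not maximum and then, by evenness, |X| ≤ |M| - 2; so ℱ ⋆ {x} has width
-- below |M|.  If a nonempty feasible A misses a maximum feasible set F, then A Δ F is feasible in
-- ℱ ⋆ A and has size |A| + |F| > |F| = w(ℱ ⋆ A).
-- Constructively, a maximum feasible set exists only up to double negation, which suffices for the
-- negative first claim.

open import Defs
open import Data.Nat using (ℕ)
open import Data.Fin using (Fin)
open import Data.Fin.Subset using (Subset; _∈_; ⁅_⁆; _∪_; ⊥; ⊤)
open import Data.Product using (∃; _×_)
open import Data.Sum using (_⊎_)
open import Relation.Nullary using (¬_)

open import Data.Bool.Properties using (xor-assoc; xor-identityˡ; xor-identityʳ; xor-same)
open import Data.Fin using (zero; suc)
open import Data.Fin.Subset using (_∉_; _∩_; ∣_∣; Empty; Nonempty; inside; outside)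
open import Data.Fin.Subset.Properties
  using (∣⊥∣≡0; ∣⊤∣≡n; ∣p∣≤n; ∣⁅x⁆∣≡1; ∉⊥; drop-∷-Empty; x∈⁅y⁆⇒x≡y; x∈p∩q⁻; x∈p∪q⁻; x∈p∪q⁺;
         x∈⁅x⁆; _∈?_; nonempty?)
open import Data.Nat using (zero; suc; _+_; _∸_; _%_; _≤_; _<_; z≤n; s≤s)
open import Data.Nat.Properties
open import Data.Product using (_,_)
open import Data.Sum using (inj₁)
import Data.Sum as Sum
open import Data.Vec using ([]; _∷_; here; there)
open import Data.Vec.Properties using (zipWith-assoc; zipWith-identityˡ; zipWith-identityʳ;
                                       zipWith-inverseˡ; map-id)
open import Function using (id)
open import Relation.Nullary using (yes; no; contradiction; ¬¬-excluded-middle)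
open import Relation.Nullary.Decidable using (decidable-stable)
open import Relation.Binary.PropositionalEquality
  using (_≡_; _≢_; refl; sym; trans; cong; subst; module ≡-Reasoning)

private
  variable
    n w : ℕ

Δ-assoc : ∀ (p q r : Subset n) → (p Δ q) Δ r ≡ p Δ (q Δ r)
Δ-assoc = zipWith-assoc xor-assoc

Δ-identityˡ : ∀ (p : Subset n) → ⊥ Δ p ≡ p
Δ-identityˡ = zipWith-identityˡ xor-identityˡ

Δ-identityʳ : ∀ (p : Subset n) → p Δ ⊥ ≡ p
Δ-identityʳ = zipWith-identityʳ xor-identityʳ

Δ-same : ∀ (p : Subset n) → p Δ p ≡ ⊥
Δ-same p = trans (cong (_Δ p) (sym (map-id p))) (zipWith-inverseˡ {⁻¹ = id} xor-same p)

pΔq≡⊥⇒p≡q : ∀ (p q : Subset n) → p Δ q ≡ ⊥ → p ≡ q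
pΔq≡⊥⇒p≡q p q pΔq≡⊥ = sym (begin
  q            ≡⟨ Δ-identityˡ q ⟨
  ⊥ Δ q        ≡⟨ cong (_Δ q) (Δ-same p) ⟨
  (p Δ p) Δ q  ≡⟨ Δ-assoc p p q ⟩
  p Δ (p Δ q)  ≡⟨ cong (p Δ_) pΔq≡⊥ ⟩
  p Δ ⊥        ≡⟨ Δ-identityʳ p ⟩
  p            ∎)
  where open ≡-Reasoning

∣p∣≡0⇒p≡⊥ : ∀ (p : Subset n) → ∣ p ∣ ≡ 0 → p ≡ ⊥
∣p∣≡0⇒p≡⊥ []            _     = refl
∣p∣≡0⇒p≡⊥ (outside ∷ p) ∣p∣≡0 = cong (outside ∷_) (∣p∣≡0⇒p≡⊥ p ∣p∣≡0)

∣pΔq∣≡∣p∣+∣q∣ : ∀ (p q : Subset n) → Empty (p ∩ q) → ∣ p Δ q ∣ ≡ ∣ p ∣ + ∣ q ∣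
∣pΔq∣≡∣p∣+∣q∣ []            []            _ = refl
∣pΔq∣≡∣p∣+∣q∣ (inside  ∷ p) (inside  ∷ q) e = contradiction (zero , here) e
∣pΔq∣≡∣p∣+∣q∣ (inside  ∷ p) (outside ∷ q) e = cong suc (∣pΔq∣≡∣p∣+∣q∣ p q (drop-∷-Empty e))
∣pΔq∣≡∣p∣+∣q∣ (outside ∷ p) (inside  ∷ q) e =
  trans (cong suc (∣pΔq∣≡∣p∣+∣q∣ p q (drop-∷-Empty e))) (sym (+-suc ∣ p ∣ ∣ q ∣))
∣pΔq∣≡∣p∣+∣q∣ (outside ∷ p) (outside ∷ q) e = ∣pΔq∣≡∣p∣+∣q∣ p q (drop-∷-Empty e)

x∈p⇒∣⁅x⁆Δp∣<∣p∣ : ∀ (x : Fin n) (p : Subset n) → x ∈ p → ∣ ⁅ x ⁆ Δ p ∣ < ∣ p ∣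
x∈p⇒∣⁅x⁆Δp∣<∣p∣ zero    (inside  ∷ p) _           = s≤s (≤-reflexive (cong ∣_∣ (Δ-identityˡ p)))
x∈p⇒∣⁅x⁆Δp∣<∣p∣ (suc x) (inside  ∷ p) (there x∈p) = s≤s (x∈p⇒∣⁅x⁆Δp∣<∣p∣ x p x∈p)
x∈p⇒∣⁅x⁆Δp∣<∣p∣ (suc x) (outside ∷ p) (there x∈p) = x∈p⇒∣⁅x⁆Δp∣<∣p∣ x p x∈p

x∉p⇒∣⁅x⁆Δp∣≡1+∣p∣ : ∀ (x : Fin n) (p : Subset n) → x ∉ p → ∣ ⁅ x ⁆ Δ p ∣ ≡ suc ∣ p ∣
x∉p⇒∣⁅x⁆Δp∣≡1+∣p∣ x p x∉p = begin
  ∣ ⁅ x ⁆ Δ p ∣      ≡⟨ ∣pΔq∣≡∣p∣+∣q∣ ⁅ x ⁆ p disjoint ⟩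
  ∣ ⁅ x ⁆ ∣ + ∣ p ∣  ≡⟨ cong (_+ ∣ p ∣) (∣⁅x⁆∣≡1 x) ⟩
  suc ∣ p ∣          ∎
  where
  open ≡-Reasoning
  disjoint : Empty (⁅ x ⁆ ∩ p)
  disjoint (y , y∈⁅x⁆∩p) with x∈p∩q⁻ ⁅ x ⁆ p y∈⁅x⁆∩p
  ... | y∈⁅x⁆ , y∈p = x∉p (subst (_∈ p) (x∈⁅y⁆⇒x≡y x y∈⁅x⁆) y∈p)

⁅x⁆∪p≢⊥ : ∀ (x : Fin n) (p : Subset n) → ⁅ x ⁆ ∪ p ≢ ⊥
⁅x⁆∪p≢⊥ x p x∪p≡⊥ = ∉⊥ (subst (x ∈_) x∪p≡⊥ (x∈p∪q⁺ (inj₁ (x∈⁅x⁆ x))))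

x∈⁅a⁆∪⁅b⁆⇒x≡a⊎x≡b : ∀ {x} (a b : Fin n) → x ∈ ⁅ a ⁆ ∪ ⁅ b ⁆ → x ≡ a ⊎ x ≡ b
x∈⁅a⁆∪⁅b⁆⇒x≡a⊎x≡b a b x∈ab = Sum.map (x∈⁅y⁆⇒x≡y a) (x∈⁅y⁆⇒x≡y b) (x∈p∪q⁻ ⁅ a ⁆ ⁅ b ⁆ x∈ab)

n%2≢1+n%2 : ∀ n → n % 2 ≢ suc n % 2
n%2≢1+n%2 zero    ()
n%2≢1+n%2 (suc n) eq = n%2≢1+n%2 n (sym eq)

o≡m∸n⇒n≡0 : ∀ {m n o} → m ≤ o → n ≤ o → o ≡ m ∸ n → n ≡ 0
o≡m∸n⇒n≡0 {n = zero} _   _   _    = refl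
o≡m∸n⇒n≡0 {zero}  {suc n} _   n≤o refl = contradiction n≤o λ ()
o≡m∸n⇒n≡0 {suc m} {suc n} m<o _   eq   =
  contradiction (≤-trans (s≤s (subst (_≤ m) (sym eq) (m∸n≤m m n))) m<o) (<-irrefl refl)

module _ {ℱ : SetSystem n} where

  ¬¬-∃-maxFeasible : ∀ {F} → ℱ F → ¬ ¬ ∃ (IsMaxFeasible ℱ)
  ¬¬-∃-maxFeasible {F} ℱF = climb n F ℱF (m≤m+n n ∣ F ∣)
    where
    open ≤-Reasoning
    climb : ∀ k F → ℱ F → n ≤ k + ∣ F ∣ → ¬ ¬ ∃ (IsMaxFeasible ℱ)
    climb zero    F ℱF n≤∣F∣ ¬max = ¬max (F , ℱF , λ Y _ → ≤-trans (∣p∣≤n Y) n≤∣F∣)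
    climb (suc k) F ℱF n≤1+k+∣F∣ ¬max = ¬¬-excluded-middle {A = ∃ λ G → ℱ G × ∣ F ∣ < ∣ G ∣} λ where
      (yes (G , ℱG , ∣F∣<∣G∣)) → climb k G ℱG (begin
        n                ≤⟨ n≤1+k+∣F∣ ⟩
        suc k + ∣ F ∣    ≡⟨ +-suc k ∣ F ∣ ⟨
        k + suc ∣ F ∣    ≤⟨ +-monoʳ-≤ k ∣F∣<∣G∣ ⟩
        k + ∣ G ∣        ∎) ¬max
      (no ∄larger) → ¬max (F , ℱF , λ Y ℱY → ≮⇒≥ λ ∣F∣<∣Y∣ → ∄larger (Y , ℱY , ∣F∣<∣Y∣))

  ⊥-isMinFeasible : ℱ ⊥ → IsMinFeasible ℱ ⊥
  ⊥-isMinFeasible ℱ⊥ = ℱ⊥ , λ Y _ → subst (_≤ ∣ Y ∣) (sym (∣⊥∣≡0 n)) z≤n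

  ⊤-isMaxFeasible : ℱ ⊤ → IsMaxFeasible ℱ ⊤
  ⊤-isMaxFeasible ℱ⊤ = ℱ⊤ , λ Y _ → subst (∣ Y ∣ ≤_) (sym (∣⊤∣≡n n)) (∣p∣≤n Y)

  hasWidth-max : ∀ {M} → ℱ ⊥ → IsMaxFeasible ℱ M → HasWidth ℱ ∣ M ∣
  hasWidth-max {M} ℱ⊥ maxM = M , ⊥ , maxM , ⊥-isMinFeasible ℱ⊥ , cong (∣ M ∣ ∸_) (sym (∣⊥∣≡0 n))

  hasWidth⇒∃feasible≥ : HasWidth ℱ w → ∃ λ Y → ℱ Y × w ≤ ∣ Y ∣
  hasWidth⇒∃feasible≥ (M , m , (ℱM , _) , _ , w≡) = M , ℱM , subst (_≤ ∣ M ∣) (sym w≡) (m∸n≤m ∣ M ∣ ∣ m ∣)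

  hasWidth⇒feasible≤ : ℱ ⊥ → HasWidth ℱ w → ∀ {Y} → ℱ Y → ∣ Y ∣ ≤ w
  hasWidth⇒feasible≤ {w} ℱ⊥ (M , m , (_ , maxM) , (_ , minm) , w≡) {Y} ℱY = begin
    ∣ Y ∣          ≤⟨ maxM Y ℱY ⟩
    ∣ M ∣          ≡⟨ cong (∣ M ∣ ∸_) ∣m∣≡0 ⟨
    ∣ M ∣ ∸ ∣ m ∣  ≡⟨ w≡ ⟨
    w              ∎
    where
    open ≤-Reasoning
    ∣m∣≡0 : ∣ m ∣ ≡ 0
    ∣m∣≡0 = n≤0⇒n≡0 (subst (∣ m ∣ ≤_) (∣⊥∣≡0 n) (minm ⊥ ℱ⊥))

  hasWidth-n⇒⊥-feasible : HasWidth ℱ n → ℱ ⊥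
  hasWidth-n⇒⊥-feasible (M , m , _ , (ℱm , _) , n≡) =
    subst ℱ (∣p∣≡0⇒p≡⊥ m (o≡m∸n⇒n≡0 (∣p∣≤n M) (∣p∣≤n m) n≡)) ℱm

  even⇒∣F∣≢1+∣G∣ : IsEven ℱ → ∀ {F G} → ℱ F → ℱ G → ∣ F ∣ ≢ suc ∣ G ∣
  even⇒∣F∣≢1+∣G∣ even {F} {G} ℱF ℱG ∣F∣≡1+∣G∣ =
    n%2≢1+n%2 ∣ G ∣ (trans (even G F ℱG ℱF) (cong (_% 2) ∣F∣≡1+∣G∣))

  twist-⊥⇒feasible : ∀ {A} → twist ℱ A ⊥ → ℱ A
  twist-⊥⇒feasible {A} (X , ℱX , ⊥≡AΔX) = subst ℱ (sym (pΔq≡⊥⇒p≡q A X (sym ⊥≡AΔX))) ℱX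

  feasible⇒twist-⊥ : ∀ {A} → ℱ A → twist ℱ A ⊥
  feasible⇒twist-⊥ {A} ℱA = A , ℱA , sym (Δ-same A)

module _ {ℱ : SetSystem n} where

  commonElement⇒twist-smaller : IsEven ℱ → ∀ {x M} → IsMaxFeasible ℱ M →
                                (∀ F → IsMaxFeasible ℱ F → x ∈ F) →
                                ∀ {X} → ℱ X → ∣ ⁅ x ⁆ Δ X ∣ < ∣ M ∣
  commonElement⇒twist-smaller even {x} {M} (ℱM , maxM) x∈max {X} ℱX with x ∈? X
  ... | yes x∈X = <-≤-trans (x∈p⇒∣⁅x⁆Δp∣<∣p∣ x X x∈X) (maxM X ℱX)
  ... | no  x∉X = subst (_< ∣ M ∣) (sym (x∉p⇒∣⁅x⁆Δp∣≡1+∣p∣ x X x∉X)) 1+∣X∣<∣M∣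
    where
    ∣X∣<∣M∣ : ∣ X ∣ < ∣ M ∣
    ∣X∣<∣M∣ = ≤∧≢⇒< (maxM X ℱX) λ ∣X∣≡∣M∣ →
      x∉X (x∈max X (ℱX , λ Y ℱY → subst (∣ Y ∣ ≤_) (sym ∣X∣≡∣M∣) (maxM Y ℱY)))
    1+∣X∣<∣M∣ : suc ∣ X ∣ < ∣ M ∣
    1+∣X∣<∣M∣ = ≤∧≢⇒< ∣X∣<∣M∣ λ 1+∣X∣≡∣M∣ → even⇒∣F∣≢1+∣G∣ even ℱM ℱX (sym 1+∣X∣≡∣M∣)

  commonElement⇒¬twistWidth : IsEven ℱ → ∀ {x M} → IsMaxFeasible ℱ M →
                              (∀ F → IsMaxFeasible ℱ F → x ∈ F) →
                              ¬ HasWidth (twist ℱ ⁅ x ⁆) ∣ M ∣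
  commonElement⇒¬twistWidth even maxM x∈max width with hasWidth⇒∃feasible≥ width
  ... | _ , (X , ℱX , refl) , ∣M∣≤ = <⇒≱ (commonElement⇒twist-smaller even maxM x∈max ℱX) ∣M∣≤

  feasible-meets-maxFeasible : ∀ {A F} → ℱ A → A ≢ ⊥ → HasWidth (twist ℱ A) ∣ F ∣ → ℱ F →
                               Nonempty (A ∩ F)
  feasible-meets-maxFeasible {A} {F} ℱA A≢⊥ width ℱF =
    decidable-stable (nonempty? (A ∩ F)) λ disjoint →
      A≢⊥ (∣p∣≡0⇒p≡⊥ A (n≤0⇒n≡0 (+-cancelʳ-≤ ∣ F ∣ ∣ A ∣ 0 (∣A∣+∣F∣≤∣F∣ disjoint))))
    where
    open ≤-Reasoning
    ∣A∣+∣F∣≤∣F∣ : Empty (A ∩ F) → ∣ A ∣ + ∣ F ∣ ≤ ∣ F ∣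
    ∣A∣+∣F∣≤∣F∣ disjoint = begin
      ∣ A ∣ + ∣ F ∣  ≡⟨ ∣pΔq∣≡∣p∣+∣q∣ A F disjoint ⟨
      ∣ A Δ F ∣      ≤⟨ hasWidth⇒feasible≤ (feasible⇒twist-⊥ ℱA) width (F , ℱF , refl) ⟩
      ∣ F ∣          ∎

  feasiblePair-meets-maxFeasible : ∀ {a b F} → ℱ (⁅ a ⁆ ∪ ⁅ b ⁆) →
                                   HasWidth (twist ℱ (⁅ a ⁆ ∪ ⁅ b ⁆)) ∣ F ∣ → ℱ F → a ∈ F ⊎ b ∈ F
  feasiblePair-meets-maxFeasible {a} {b} {F} ℱab width ℱF
    with feasible-meets-maxFeasible ℱab (⁅x⁆∪p≢⊥ a ⁅ b ⁆) width ℱF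
  ... | y , y∈ab∩F with x∈p∩q⁻ (⁅ a ⁆ ∪ ⁅ b ⁆) F y∈ab∩F
  ... | y∈ab , y∈F = Sum.map (λ y≡a → subst (_∈ F) y≡a y∈F) (λ y≡b → subst (_∈ F) y≡b y∈F)
                             (x∈⁅a⁆∪⁅b⁆⇒x≡a⊎x≡b a b y∈ab)

mainTheorem3 : ∀ (n : ℕ) (ℱ : SetSystem n) → IsDeltaMatroid ℱ → ℱ ⊥ →
    (∀ (A : Subset n) (w : ℕ) → HasWidth ℱ w → HasWidth (twist ℱ A) w) →
    ((IsEven ℱ →
    (¬ (∃ λ (x : Fin n) → ∀ F → IsMaxFeasible ℱ F → x ∈ F))
    × (∀ (a b : Fin n) → ℱ (⁅ a ⁆ ∪ ⁅ b ⁆) → ∀ F → IsMaxFeasible ℱ F → a ∈ F ⊎ b ∈ F))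
    × (ℱ ⊤ → ∀ (X : Subset n) → ℱ X))
mainTheorem3 n ℱ _ ℱ⊥ twistWidth = (λ even → noCommonElement even , pairMeetsMax) , allFeasible
  where
  noCommonElement : IsEven ℱ → ¬ (∃ λ (x : Fin n) → ∀ F → IsMaxFeasible ℱ F → x ∈ F)
  noCommonElement even (x , x∈max) = ¬¬-∃-maxFeasible ℱ⊥ λ (M , maxM) →
    commonElement⇒¬twistWidth even maxM x∈max (twistWidth ⁅ x ⁆ ∣ M ∣ (hasWidth-max ℱ⊥ maxM))

  pairMeetsMax : ∀ a b → ℱ (⁅ a ⁆ ∪ ⁅ b ⁆) → ∀ F → IsMaxFeasible ℱ F → a ∈ F ⊎ b ∈ F
  pairMeetsMax a b ℱab F maxF@(ℱF , _) =
    feasiblePair-meets-maxFeasible ℱab (twistWidth (⁅ a ⁆ ∪ ⁅ b ⁆) ∣ F ∣ (hasWidth-max ℱ⊥ maxF)) ℱF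

  allFeasible : ℱ ⊤ → ∀ X → ℱ X
  allFeasible ℱ⊤ X = twist-⊥⇒feasible (hasWidth-n⇒⊥-feasible
    (twistWidth X n (subst (HasWidth ℱ) (∣⊤∣≡n n) (hasWidth-max ℱ⊥ (⊤-isMaxFeasible ℱ⊤)))))
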